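{- Let $G$ be a connected rooted graph, let $n=|G|$, and let $k\geq 1$ be an integer. Let $G^k$ be the rooted $k$-th power of $G$. Then \[\delta\left(G^{k}\right)=a_k(n)\,\delta(G)+b_k(n)\,\delta_0(G),\] where $a_k(n)=n^{k-1}\frac{n^{k}-1}{n-1}$ and $b_k(n)=2(k-1)n^{2k-1}-2n^{k}\frac{n^{k-1}-1}{n-1}$, with $\frac{n^{m}-1}{n-1}$ understood as the polynomial $1+n+\cdots+n^{m-1}$ (equal to $0$ when $m=0$).
   Context: A rooted graph is a finite simple undirected graph $G$ with a distinguished vertex $v_0(G)$ (the root); $|G|$ is its number of vertices. For connected $G$, $d(i,j)$ is the shortest-path distance, $\delta(G)=\sum_{i,j\in V(G)}d(i,j)$ (sum over ordered pairs) is the transmission, and $\delta_0(G)=\sum_{j\in V(G)} d(v_0(G),j)$ is the transmission of the root. The rooted product $G\circ H$ of rooted graphs $G,H$ has vertex set $V(G)\times V(H)$, root $(v_0(G),v_0(H))$, and $(g,h)\sim(g',h')$ iff either ($h=h'=v_0(H)$ and $g\sim_G g'$) or ($g=g'$ and $h\sim_H h'$). The rooted $k$-th power is defined by $G^1=G$ and $G^{k+1}=G^k\circ G$. -}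

module Defs where

open import Data.Nat using (ℕ; zero; suc; _+_; _*_; _∸_; _^_; _<_)
open import Data.Fin using (Fin; remQuot; combine; _≟_)
open import Data.Bool using (Bool; true; false; _∧_; _∨_; if_then_else_)
open import Data.Product using (_×_; _,_; proj₁; proj₂; ∃)
open import Relation.Nullary.Decidable using (⌊_⌋)
open import Relation.Binary.PropositionalEquality using (_≡_)

sumFin : (n : ℕ) → (Fin n → ℕ) → ℕ
sumFin zero    f = 0
sumFin (suc n) f = f Data.Fin.zero + sumFin n (λ i → f (Data.Fin.suc i))

anyFin : (n : ℕ) → (Fin n → Bool) → Bool
anyFin zero    f = false
anyFin (suc n) f = f Data.Fin.zero ∨ anyFin n (λ i → f (Data.Fin.suc i))

record RGraph : Set where
  constructor rgraph
  field
    size : ℕ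
    adj  : Fin size → Fin size → Bool
    root : Fin size
open RGraph public

Simple : RGraph → Set
Simple G = (∀ i j → adj G i j ≡ adj G j i) × (∀ i → adj G i i ≡ false)

data Walk (G : RGraph) : Fin (size G) → Fin (size G) → ℕ → Set where
  here : ∀ {i} → Walk G i i 0
  step : ∀ {i j k m} → adj G i j ≡ true → Walk G j k m → Walk G i k (suc m)

Connected : RGraph → Set
Connected G = ∀ i j → ∃ λ m → Walk G i j m

reach : (G : RGraph) → ℕ → Fin (size G) → Fin (size G) → Bool
reach G zero    i j = ⌊ i ≟ j ⌋
reach G (suc m) i j = reach G m i j ∨ anyFin (size G) (λ l → reach G m i l ∧ adj G l j)

searchDist : (G : RGraph) → Fin (size G) → Fin (size G) → ℕ → ℕ → ℕ
searchDist G i j c zero       = c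
searchDist G i j c (suc fuel) = if reach G c i j then c else searchDist G i j (suc c) fuel

-- Shortest-path distance: least m such that a walk of length ≤ m exists
-- (search over m = 0 .. size G; for connected graphs it is found).
dist : (G : RGraph) → Fin (size G) → Fin (size G) → ℕ
dist G i j = searchDist G i j 0 (size G)

-- Transmission (sum over ordered pairs) and transmission of the root.
δ : RGraph → ℕ
δ G = sumFin (size G) (λ i → sumFin (size G) (λ j → dist G i j))

δ₀ : RGraph → ℕ
δ₀ G = sumFin (size G) (λ j → dist G (root G) j)

-- Rooted product G ∘ H, vertex (g , h) encoded as combine g h.
_∘ᴿ_ : RGraph → RGraph → RGraph
G ∘ᴿ H = rgraph (size G * size H) a (combine (root G) (root H))
  where
    a : Fin (size G * size H) → Fin (size G * size H) → Bool
    a x y with remQuot (size H) x | remQuot (size H) y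
    ... | g , h | g' , h' =
      (⌊ h ≟ root H ⌋ ∧ ⌊ h' ≟ root H ⌋ ∧ adj G g g')
      ∨ (⌊ g ≟ g' ⌋ ∧ adj H h h')

-- Rooted k-th power for k ≥ 1: G^1 = G, G^(k+1) = G^k ∘ G.
-- (The value at k = 0 is an irrelevant placeholder, excluded by 1 ≤ k.)
rpow : RGraph → ℕ → RGraph
rpow G zero          = G
rpow G (suc zero)    = G
rpow G (suc (suc k)) = rpow G (suc k) ∘ᴿ G

geom : ℕ → ℕ → ℕ
geom n zero    = 0
geom n (suc m) = geom n m + n ^ m

-- In a connected graph every walk can be shortened below |G|
--   (pigeonhole on its vertices), so the bounded search `dist` returns the
--   length of a shortest walk; in a simple graph walks reverse, so `dist` is
--   symmetric.  A ∘ H is again simple and connected, its distances are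
--   d_H(h,h') inside a fibre and d_H(h,r) + d_A(g,g') + d_H(r,h') between
--   different fibres, and summing gives, with N = |A|, M = |H|,
--     δ(A ∘ H) + 2NM δ₀(H) = N δ(H) + M² δ(A) + 2N²M δ₀(H).  With A = G^(j+1), H = G this recurrence determines δ(G^(j+2));
--   the closed form follows by induction on j, the inductive step being a
--   polynomial identity in ℤ once n^j is written as n g + 1 - g, where
--   g = 1 + n + ... + n^(j-1).
module Submission where

open import Defs

module Distance where

  open import Data.Nat using (ℕ; zero; suc; _+_; _∸_; _≤_; _<_; z≤n; s≤s; _<?_)
  open import Data.Nat.Properties
    using (≤-refl; ≤-trans; ≤-antisym; ≤-pred; <⇒≤; ≤-<-trans; ≮⇒≥; ≰⇒>; m≤n⇒m≤1+n;
           m≤n⇒m<n∨m≡n; n≤0⇒n≡0; +-identityʳ; +-suc; +-monoˡ-<; m+[n∸m]≡n)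
  open import Data.Fin using (Fin; toℕ; _≟_)
  import Data.Fin as Fin
  open import Data.Fin.Properties using (pigeonhole; toℕ<n)
  open import Data.Bool using (Bool; true; false; _∧_; _∨_)
  open import Data.Bool.Properties using (∨-zeroʳ)
  open import Data.Product using (_×_; _,_; proj₁; proj₂; ∃)
  open import Data.Sum using (inj₁; inj₂)
  open import Data.Empty using (⊥-elim)
  open import Function using (case_of_)
  open import Relation.Nullary using (yes; no)
  open import Relation.Nullary.Decidable using (⌊_⌋)
  open import Relation.Binary.PropositionalEquality

  ∧-true : ∀ {a b} → a ∧ b ≡ true → a ≡ true × b ≡ true
  ∧-true {true} {true} _ = refl , refl

  anyFin-intro : ∀ n (f : Fin n → Bool) i → f i ≡ true → anyFin n f ≡ true
  anyFin-intro (suc n) f Fin.zero    fi = cong (_∨ anyFin n (λ i → f (Fin.suc i))) fi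
  anyFin-intro (suc n) f (Fin.suc i) fi =
    trans (cong (f Fin.zero ∨_) (anyFin-intro n (λ i → f (Fin.suc i)) i fi)) (∨-zeroʳ _)

  anyFin-elim : ∀ n (f : Fin n → Bool) → anyFin n f ≡ true → ∃ λ i → f i ≡ true
  anyFin-elim (suc n) f any with f Fin.zero in f0
  ... | true  = Fin.zero , f0
  ... | false with anyFin-elim n (λ i → f (Fin.suc i)) any
  ...   | i , fi = Fin.suc i , fi

  ⌊≟⌋-refl : ∀ {n} (i : Fin n) → ⌊ i ≟ i ⌋ ≡ true
  ⌊≟⌋-refl i with i ≟ i
  ... | yes _  = refl
  ... | no i≢i = ⊥-elim (i≢i refl)

  module _ {G : RGraph} where

    _++ʷ_ : ∀ {i j k m m'} → Walk G i j m → Walk G j k m' → Walk G i k (m + m')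
    here     ++ʷ w' = w'
    step e w ++ʷ w' = step e (w ++ʷ w')

    snoc : ∀ {i l k m} → Walk G i l m → adj G l k ≡ true → Walk G i k (suc m)
    snoc here       e = step e here
    snoc (step e w) e' = step e (snoc w e')

    unsnoc : ∀ {i k m} → Walk G i k (suc m) → ∃ λ l → Walk G i l m × adj G l k ≡ true
    unsnoc (step e here) = _ , here , e
    unsnoc (step e (step e' w)) with unsnoc (step e' w)
    ... | l , w'' , e'' = l , step e w'' , e''

    vertexAt : ∀ {i j m} → Walk G i j m → ℕ → Fin (size G)
    vertexAt {i} here       p       = i
    vertexAt {i} (step e w) zero    = i
    vertexAt     (step e w) (suc p) = vertexAt w p

    prefix : ∀ {i j m} (w : Walk G i j m) p → p ≤ m → Walk G i (vertexAt w p) p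
    prefix here       zero    _       = here
    prefix (step e w) zero    _       = here
    prefix (step e w) (suc p) (s≤s p≤m) = step e (prefix w p p≤m)

    suffix : ∀ {i j m} (w : Walk G i j m) p → p ≤ m → Walk G (vertexAt w p) j (m ∸ p)
    suffix here       zero    _       = here
    suffix (step e w) zero    _       = step e w
    suffix (step e w) (suc p) (s≤s p≤m) = suffix w p p≤m

    reverse : (∀ i j → adj G i j ≡ adj G j i) → ∀ {i j m} → Walk G i j m → Walk G j i m
    reverse sym-adj here       = here
    reverse sym-adj (step e w) = snoc (reverse sym-adj w) (trans (sym-adj _ _) e)

  reach-complete : ∀ (G : RGraph) {i j m} → Walk G i j m → reach G m i j ≡ true
  reach-complete G {i} here = ⌊≟⌋-refl i
  reach-complete G {i} {j} {suc m} w with unsnoc w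
  ... | l , w' , e = trans (cong (reach G m i j ∨_) any) (∨-zeroʳ _)
    where
    any : anyFin (size G) (λ l → reach G m i l ∧ adj G l j) ≡ true
    any = anyFin-intro (size G) _ l (cong₂ _∧_ (reach-complete G w') e)

  reach-sound : ∀ (G : RGraph) m i j → reach G m i j ≡ true → ∃ λ m' → m' ≤ m × Walk G i j m'
  reach-sound G zero i j r with i ≟ j
  ... | yes refl = 0 , z≤n , here
  reach-sound G (suc m) i j r with reach G m i j in r'
  ... | true with reach-sound G m i j r'
  ...   | m' , m'≤m , w = m' , m≤n⇒m≤1+n m'≤m , w
  reach-sound G (suc m) i j r | false
    with anyFin-elim (size G) (λ l → reach G m i l ∧ adj G l j) r
  ... | l , rl with ∧-true rl
  ...   | r'' , e with reach-sound G m i l r''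
  ...     | m' , m'≤m , w = suc m' , s≤s m'≤m , snoc w e

  search-least : ∀ (G : RGraph) i j c fuel → (∀ c' → c' < c → reach G c' i j ≡ false) →
    ∀ m → m < c + fuel → reach G m i j ≡ true →
    reach G (searchDist G i j c fuel) i j ≡ true ×
    (∀ c' → c' < searchDist G i j c fuel → reach G c' i j ≡ false)
  search-least G i j c zero below m m<c r
    with () ← trans (sym r) (below m (subst (m <_) (+-identityʳ c) m<c))
  search-least G i j c (suc fuel) below m m<c+ r with reach G c i j in rc
  ... | true  = rc , below
  ... | false = search-least G i j (suc c) fuel below′ m (subst (m <_) (+-suc c fuel) m<c+) r
    where
    below′ : ∀ c' → c' < suc c → reach G c' i j ≡ false
    below′ c' c'<1+c with m≤n⇒m<n∨m≡n (≤-pred c'<1+c)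
    ... | inj₁ c'<c  = below c' c'<c
    ... | inj₂ refl = rc

  Shortest : (G : RGraph) → Fin (size G) → Fin (size G) → ℕ → Set
  Shortest G i j d = Walk G i j d × (∀ m → Walk G i j m → d ≤ m)

  shortest-unique : ∀ {G i j d d'} → Shortest G i j d → Shortest G i j d' → d ≡ d'
  shortest-unique (w , least) (w' , least') = ≤-antisym (least _ w') (least' _ w)

  dist-shortest-if-short : ∀ (G : RGraph) {i j m} → Walk G i j m → m < size G →
    Shortest G i j (dist G i j)
  dist-shortest-if-short G {i} {j} w m<n
    with search-least G i j 0 (size G) (λ _ ()) _ m<n (reach-complete G w)
  ... | reaches , below with reach-sound G _ i j reaches
  ...   | m' , m'≤d , w' = subst (Walk G i j) (≤-antisym m'≤d (least m' w')) w' , least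
    where
    least : ∀ m'' → Walk G i j m'' → dist G i j ≤ m''
    least m'' w'' = ≮⇒≥ λ m''<d → case trans (sym (reach-complete G w'')) (below m'' m''<d) of λ ()

  -- Pigeonhole: a walk of length ≥ |G| visits some vertex twice, and cutting out
  -- the cycle between the two visits shortens it; repeating gives a walk shorter than |G|.
  shortWalk : ∀ (G : RGraph) fuel {i j m} → Walk G i j m → m ≤ fuel →
    ∃ λ m' → m' < size G × Walk G i j m'
  shortWalk G fuel {i} {j} {m} w m≤fuel with m <? size G
  ... | yes m<n = m , m<n , w
  shortWalk G zero {i} here z≤n | no m≮n = ⊥-elim (m≮n (≤-<-trans z≤n (toℕ<n i)))
  shortWalk G (suc fuel) {i} {j} {m} w m≤fuel | no m≮n
    with pigeonhole (≰⇒> m≮n) (λ p → vertexAt w (toℕ p))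
  ... | a , b , a<b , same = shortWalk G fuel (prefix w (toℕ a) a≤m ++ʷ suffix′) shorter
    where
    b≤m : toℕ b ≤ m
    b≤m = ≤-pred (toℕ<n b)
    a≤m : toℕ a ≤ m
    a≤m = ≤-trans (<⇒≤ a<b) b≤m
    suffix′ : Walk G (vertexAt w (toℕ a)) j (m ∸ toℕ b)
    suffix′ = subst (λ v → Walk G v j (m ∸ toℕ b)) (sym same) (suffix w (toℕ b) b≤m)
    shorter : toℕ a + (m ∸ toℕ b) ≤ fuel
    shorter = ≤-pred (≤-trans (subst (toℕ a + (m ∸ toℕ b) <_) (m+[n∸m]≡n b≤m)
                                (+-monoˡ-< (m ∸ toℕ b) a<b)) m≤fuel)

  module _ {G : RGraph} (connected : Connected G) where

    dist-shortest : ∀ i j → Shortest G i j (dist G i j)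
    dist-shortest i j with connected i j
    ... | m , w with shortWalk G m w ≤-refl
    ...   | m' , m'<n , w' = dist-shortest-if-short G w' m'<n

    dist-unique : ∀ {i j d} → Shortest G i j d → dist G i j ≡ d
    dist-unique = shortest-unique (dist-shortest _ _)

    dist-walk : ∀ i j → Walk G i j (dist G i j)
    dist-walk i j = proj₁ (dist-shortest i j)

    dist-refl : ∀ i → dist G i i ≡ 0
    dist-refl i = n≤0⇒n≡0 (proj₂ (dist-shortest i i) 0 here)

    dist-edge : ∀ {i l} j → adj G i l ≡ true → dist G i j ≤ suc (dist G l j)
    dist-edge {i} {l} j e = proj₂ (dist-shortest i j) _ (step e (dist-walk l j))

  dist-sym : ∀ {G} → Simple G → (connected : Connected G) → ∀ i j → dist G i j ≡ dist G j i
  dist-sym (sym-adj , _) connected i j =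
    ≤-antisym (proj₂ (dist-shortest connected i j) _ (reverse sym-adj (dist-walk connected j i)))
              (proj₂ (dist-shortest connected j i) _ (reverse sym-adj (dist-walk connected i j)))

module Sums where

  open import Data.Nat using (ℕ; zero; suc; _+_; _*_)
  open import Data.Nat.Properties using (+-assoc; *-zeroʳ; *-distribˡ-+; +-identityʳ)
  open import Data.Nat.Tactic.RingSolver using (solve-∀)
  open import Data.Fin using (Fin; zero; suc; combine; _↑ˡ_; _↑ʳ_; _≟_)
  open import Relation.Nullary using (yes; no)
  open import Relation.Binary.PropositionalEquality

  sum-cong : ∀ n {f f' : Fin n → ℕ} → (∀ i → f i ≡ f' i) → sumFin n f ≡ sumFin n f'
  sum-cong zero    eq = refl
  sum-cong (suc n) eq = cong₂ _+_ (eq zero) (sum-cong n (λ i → eq (suc i)))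

  sum-+ : ∀ n (f f' : Fin n → ℕ) → sumFin n (λ i → f i + f' i) ≡ sumFin n f + sumFin n f'
  sum-+ zero    f f' = refl
  sum-+ (suc n) f f' rewrite sum-+ n (λ i → f (suc i)) (λ i → f' (suc i)) =
    interchange (f zero) (f' zero) _ _
    where
    interchange : ∀ a b c d → a + b + (c + d) ≡ a + c + (b + d)
    interchange = solve-∀

  sum-*ˡ : ∀ n c (f : Fin n → ℕ) → sumFin n (λ i → c * f i) ≡ c * sumFin n f
  sum-*ˡ zero    c f = sym (*-zeroʳ c)
  sum-*ˡ (suc n) c f rewrite sum-*ˡ n c (λ i → f (suc i)) = sym (*-distribˡ-+ c _ _)

  sum-const : ∀ n c → sumFin n (λ _ → c) ≡ n * c
  sum-const zero    c = refl
  sum-const (suc n) c = cong (c +_) (sum-const n c)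

  sum-++ : ∀ a b (f : Fin (a + b) → ℕ) →
    sumFin (a + b) f ≡ sumFin a (λ i → f (i ↑ˡ b)) + sumFin b (λ i → f (a ↑ʳ i))
  sum-++ zero    b f = refl
  sum-++ (suc a) b f rewrite sum-++ a b (λ i → f (suc i)) = sym (+-assoc (f zero) _ _)

  sum-combine : ∀ N M (f : Fin (N * M) → ℕ) →
    sumFin (N * M) f ≡ sumFin N (λ g → sumFin M (λ h → f (combine g h)))
  sum-combine zero    M f = refl
  sum-combine (suc N) M f =
    trans (sum-++ M (N * M) f) (cong (sumFin M (λ h → f (h ↑ˡ (N * M))) +_) (sum-combine N M (λ i → f (M ↑ʳ i))))

  indicator : ∀ {n} → Fin n → Fin n → ℕ
  indicator g g' with g ≟ g'
  ... | yes _ = 1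
  ... | no _  = 0

  indicator-suc : ∀ {n} (g g' : Fin n) → indicator (suc g) (suc g') ≡ indicator g g'
  indicator-suc g g' with g ≟ g'
  ... | yes refl = refl
  ... | no _     = refl

  sum-indicator : ∀ n (g : Fin n) (f : Fin n → ℕ) → sumFin n (λ g' → indicator g g' * f g') ≡ f g
  sum-indicator (suc n) zero f =
    trans (cong₂ _+_ (+-identityʳ (f zero)) (trans (sum-const n 0) (*-zeroʳ n))) (+-identityʳ (f zero))
  sum-indicator (suc n) (suc g) f =
    trans (sum-cong n (λ g' → cong (_* f (suc g')) (indicator-suc g g')))
          (sum-indicator n g (λ g' → f (suc g')))

  sum² : ∀ N M → (Fin N → Fin M → ℕ) → ℕ
  sum² N M f = sumFin N (λ g → sumFin M (λ h → f g h))

  sum²-cong : ∀ N M {f f' : Fin N → Fin M → ℕ} → (∀ g h → f g h ≡ f' g h) → sum² N M f ≡ sum² N M f'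
  sum²-cong N M eq = sum-cong N (λ g → sum-cong M (eq g))

  sum²-+ : ∀ N M (f f' : Fin N → Fin M → ℕ) →
    sum² N M (λ g h → f g h + f' g h) ≡ sum² N M f + sum² N M f'
  sum²-+ N M f f' = trans (sum-cong N (λ g → sum-+ M (f g) (f' g))) (sum-+ N _ _)

  sum²-+₄ : ∀ N M (a b c d : Fin N → Fin M → ℕ) →
    sum² N M (λ g h → a g h + b g h + c g h + d g h)
      ≡ sum² N M a + sum² N M b + sum² N M c + sum² N M d
  sum²-+₄ N M a b c d =
    trans (sum²-+ N M _ d) (cong (_+ sum² N M d)
      (trans (sum²-+ N M _ c) (cong (_+ sum² N M c) (sum²-+ N M a b))))

  sum²-snd : ∀ N M (u : Fin M → ℕ) → sum² N M (λ _ h → u h) ≡ N * sumFin M u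
  sum²-snd N M u = sum-const N (sumFin M u)

  sum²-fst : ∀ N M (v : Fin N → ℕ) → sum² N M (λ g _ → v g) ≡ M * sumFin N v
  sum²-fst N M v = trans (sum-cong N (λ g → sum-const M (v g))) (sum-*ˡ N M v)

  sum²-indicator : ∀ N M (g : Fin N) (u : Fin M → ℕ) →
    sum² N M (λ g' h' → indicator g g' * u h') ≡ sumFin M u
  sum²-indicator N M g u =
    trans (sum-cong N (λ g' → sum-*ˡ M (indicator g g') u)) (sum-indicator N g (λ _ → sumFin M u))

module RootedProduct (A H : RGraph) where

  open import Data.Nat using (ℕ; suc; _+_; _*_; _≤_; s≤s)
  open import Data.Nat.Properties
    using (≤-refl; ≤-trans; ≤-reflexive; m≤n⇒m≤1+n; m≤n+m; +-mono-≤; +-monoʳ-≤; +-suc)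
  open import Data.Nat.Tactic.RingSolver using (solve-∀)
  open import Data.Fin using (Fin; combine; remQuot; _≟_)
  open import Data.Fin.Properties using (remQuot-combine; combine-remQuot)
  open import Data.Bool using (Bool; true; false; _∧_; _∨_; T)
  open import Data.Bool.Properties using (∨-zeroʳ; ∧-zeroʳ)
  open import Data.Product using (_×_; _,_; proj₁; proj₂)
  open import Data.Sum using (_⊎_; inj₁; inj₂)
  open import Data.Empty using (⊥-elim)
  open import Relation.Nullary using (yes; no)
  open import Relation.Nullary.Decidable using (⌊_⌋; toWitness)
  open import Relation.Binary.PropositionalEquality
  open Distance
  open Sums

  N = size A
  M = size H
  P = A ∘ᴿ H
  r = root H

  base : Fin (N * M) → Fin N
  base x = proj₁ (remQuot {N} M x)

  fibre : Fin (N * M) → Fin M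
  fibre x = proj₂ (remQuot {N} M x)

  prodAdj : Fin N → Fin M → Fin N → Fin M → Bool
  prodAdj g h g' h' = (⌊ h ≟ r ⌋ ∧ ⌊ h' ≟ r ⌋ ∧ adj A g g') ∨ (⌊ g ≟ g' ⌋ ∧ adj H h h')

  adj-combine : ∀ g h g' h' → adj P (combine g h) (combine g' h') ≡ prodAdj g h g' h'
  adj-combine g h g' h' =
    cong₂ (λ x y → prodAdj (proj₁ x) (proj₂ x) (proj₁ y) (proj₂ y))
          (remQuot-combine g h) (remQuot-combine g' h')

  ProdEdge : Fin N → Fin M → Fin N → Fin M → Set
  ProdEdge g h g' h' = (h ≡ r × h' ≡ r × adj A g g' ≡ true) ⊎ (g ≡ g' × adj H h h' ≡ true)

  ≟-true : ∀ {n} {a b : Fin n} → ⌊ a ≟ b ⌋ ≡ true → a ≡ b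
  ≟-true eq = toWitness (subst T (sym eq) _)

  prodEdge : ∀ g h g' h' → prodAdj g h g' h' ≡ true → ProdEdge g h g' h'
  prodEdge g h g' h' e with ⌊ h ≟ r ⌋ ∧ ⌊ h' ≟ r ⌋ ∧ adj A g g' in e₁
  ... | true with ∧-true e₁
  ...   | h≡r , e₂ with ∧-true e₂
  ...     | h'≡r , a = inj₁ (≟-true h≡r , ≟-true h'≡r , a)
  prodEdge g h g' h' e | false with ∧-true e
  ...   | g≡g' , a = inj₂ (≟-true g≡g' , a)

  base-edge : ∀ {g g'} → adj A g g' ≡ true → adj P (combine g r) (combine g' r) ≡ true
  base-edge {g} {g'} e rewrite adj-combine g r g' r | ⌊≟⌋-refl r | e = refl

  fibre-edge : ∀ g {h h'} → adj H h h' ≡ true → adj P (combine g h) (combine g h') ≡ true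
  fibre-edge g {h} {h'} e rewrite adj-combine g h g h' | ⌊≟⌋-refl g | e = ∨-zeroʳ _

  ∧-swap : ∀ a b c → a ∧ (b ∧ c) ≡ b ∧ (a ∧ c)
  ∧-swap true  b     c = refl
  ∧-swap false true  c = refl
  ∧-swap false false c = refl

  ⌊≟⌋-sym : ∀ {n} (a b : Fin n) → ⌊ a ≟ b ⌋ ≡ ⌊ b ≟ a ⌋
  ⌊≟⌋-sym a b with a ≟ b | b ≟ a
  ... | yes _    | yes _    = refl
  ... | yes refl | no b≢a   = ⊥-elim (b≢a refl)
  ... | no a≢b   | yes refl = ⊥-elim (a≢b refl)
  ... | no _     | no _     = refl

  prod-simple : Simple A → Simple H → Simple P
  prod-simple (symA , irrA) (symH , irrH) = symP , irrP
    where
    symP : ∀ x y → adj P x y ≡ adj P y x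
    symP x y = cong₂ _∨_
      (trans (∧-swap ⌊ fibre x ≟ r ⌋ ⌊ fibre y ≟ r ⌋ (adj A (base x) (base y))) (cong (λ t → ⌊ fibre y ≟ r ⌋ ∧ ⌊ fibre x ≟ r ⌋ ∧ t) (symA (base x) (base y))))
      (cong₂ _∧_ (⌊≟⌋-sym (base x) (base y)) (symH (fibre x) (fibre y)))
    irrP : ∀ x → adj P x x ≡ false
    irrP x rewrite irrA (base x) | irrH (fibre x) =
      cong₂ _∨_ (trans (cong (b ∧_) (∧-zeroʳ b)) (∧-zeroʳ b)) (∧-zeroʳ _)
      where b = ⌊ fibre x ≟ r ⌋

  baseWalk : ∀ {g g' m} → Walk A g g' m → Walk P (combine g r) (combine g' r) m
  baseWalk here       = here
  baseWalk (step e w) = step (base-edge e) (baseWalk w)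

  fibreWalk : ∀ g {h h' m} → Walk H h h' m → Walk P (combine g h) (combine g h') m
  fibreWalk g here       = here
  fibreWalk g (step e w) = step (fibre-edge g e) (fibreWalk g w)

  module Distances (connA : Connected A) (connH : Connected H) where

    dA = dist A
    dH = dist H

    -- The distance formula of the rooted product: inside a fibre distances are
    -- those of H; between different fibres the route passes through both roots.
    prodDist : Fin N → Fin M → Fin N → Fin M → ℕ
    prodDist g h g' h' with g ≟ g'
    ... | yes _ = dH h h'
    ... | no _  = dH h r + dA g g' + dH r h'

    prodDist-fibre : ∀ g h h' → prodDist g h g h' ≡ dH h h'
    prodDist-fibre g h h' with g ≟ g
    ... | yes _  = refl
    ... | no g≢g = ⊥-elim (g≢g refl)

    prodWalk : ∀ g h g' h' → Walk P (combine g h) (combine g' h') (prodDist g h g' h')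
    prodWalk g h g' h' with g ≟ g'
    ... | yes refl = fibreWalk g (dist-walk connH h h')
    ... | no _     = (fibreWalk g (dist-walk connH h r) ++ʷ baseWalk (dist-walk connA g g'))
                       ++ʷ fibreWalk g' (dist-walk connH r h')

    prod-connected : Connected P
    prod-connected x y = _ , subst₂ (λ u v → Walk P u v d)
      (combine-remQuot {N} M x) (combine-remQuot {N} M y) (prodWalk (base x) (fibre x) (base y) (fibre y))
      where d = prodDist (base x) (fibre x) (base y) (fibre y)

    prodDist-edge : ∀ {g h g₁ h₁} g' h' {m} → ProdEdge g h g₁ h₁ →
      prodDist g₁ h₁ g' h' ≤ m → prodDist g h g' h' ≤ suc m
    prodDist-edge {g} {g₁ = g₁} g' h' {m} (inj₁ (refl , refl , e)) ih with g ≟ g' | g₁ ≟ g'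
    ... | yes _ | yes _ = m≤n⇒m≤1+n ih
    ... | yes _ | no _  = m≤n⇒m≤1+n (≤-trans (m≤n+m (dH r h') (dH r r + dA g₁ g')) ih)
    ... | no _  | yes refl =
      subst (λ z → z + dA g g₁ + dH r h' ≤ suc m) (sym (dist-refl connH r))
            (+-mono-≤ (subst (dA g g₁ ≤_) (cong suc (dist-refl connA g₁)) (dist-edge connA g₁ e)) ih)
    ... | no _  | no _  =
      ≤-trans (+-mono-≤ (+-monoʳ-≤ (dH r r) (dist-edge connA g' e)) (≤-refl {dH r h'}))
              (subst (_≤ suc m) (sym (cong (_+ dH r h') (+-suc (dH r r) (dA g₁ g')))) (s≤s ih))
    prodDist-edge {g} {h} g' h' (inj₂ (refl , e)) ih with g ≟ g'
    ... | yes _ = ≤-trans (dist-edge connH h' e) (s≤s ih)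
    ... | no _  = ≤-trans (+-mono-≤ (+-mono-≤ (dist-edge connH r e) (≤-refl {dA g g'})) (≤-refl {dH r h'}))
                          (s≤s ih)

    prodDist-lower : ∀ {x y m} → Walk P x y m → prodDist (base x) (fibre x) (base y) (fibre y) ≤ m
    prodDist-lower {x} here = ≤-reflexive (trans (prodDist-fibre (base x) (fibre x) (fibre x)) (dist-refl connH _))
    prodDist-lower {x} (step {j = z} e w) =
      prodDist-edge (base _) (fibre _) (prodEdge (base x) (fibre x) (base z) (fibre z) e) (prodDist-lower w)

    dist-prod : ∀ g h g' h' → dist P (combine g h) (combine g' h') ≡ prodDist g h g' h'
    dist-prod g h g' h' = dist-unique prod-connected (prodWalk g h g' h' , lower)
      where
      lower : ∀ m → Walk P (combine g h) (combine g' h') m → prodDist g h g' h' ≤ m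
      lower m w = subst (_≤ m)
        (cong₂ (λ x y → prodDist (proj₁ x) (proj₂ x) (proj₁ y) (proj₂ y)) (remQuot-combine g h) (remQuot-combine g' h'))
        (prodDist-lower w)

    -- On the diagonal blocks g ≡ g' the detour through the root, added back,
    -- makes the distance formula uniform in (g, g').
    prodDist-uniform : ∀ g h g' h' →
      prodDist g h g' h' + indicator g g' * (dH h r + dH r h')
        ≡ indicator g g' * dH h h' + dA g g' + dH h r + dH r h'
    prodDist-uniform g h g' h' with g ≟ g'
    ... | yes refl = subst (λ z → dH h h' + 1 * (dH h r + dH r h') ≡ 1 * dH h h' + z + dH h r + dH r h')
                           (sym (dist-refl connA g)) (diagonal (dH h h') (dH h r) (dH r h'))
      where
      diagonal : ∀ d a c → d + 1 * (a + c) ≡ 1 * d + 0 + a + c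
      diagonal = solve-∀
    ... | no _ = offDiagonal (dH h h') (dH h r) (dA g g') (dH r h')
      where
      offDiagonal : ∀ d a b c → a + b + c + 0 * (a + c) ≡ 0 * d + b + a + c
      offDiagonal = solve-∀

    s = δ₀ H

    module Transmission (simpleH : Simple H) where

      sum-to-root : sumFin M (λ h → dH h r) ≡ s
      sum-to-root = sum-cong M (λ h → dist-sym simpleH connH h r)

      δ-coords : δ P ≡ sum² N M (λ g h → sum² N M (prodDist g h))
      δ-coords = trans (sum-combine N M _) (sum²-cong N M λ g h →
        trans (sum-combine N M _) (sum²-cong N M (dist-prod g h)))

      row-sum : ∀ g h →
        sum² N M (prodDist g h) + (M * dH h r + s)
          ≡ sumFin M (dH h) + M * sumFin N (dA g) + N * (M * dH h r) + N * s
      row-sum g h = begin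
          sum² N M (prodDist g h) + (M * dH h r + s)
        ≡⟨ cong (sum² N M (prodDist g h) +_) (sym detour) ⟩
          sum² N M (prodDist g h) + sum² N M (λ g' h' → indicator g g' * (dH h r + dH r h'))
        ≡⟨ sym (sum²-+ N M _ _) ⟩
          sum² N M (λ g' h' → prodDist g h g' h' + indicator g g' * (dH h r + dH r h'))
        ≡⟨ sum²-cong N M (prodDist-uniform g h) ⟩
          sum² N M (λ g' h' → indicator g g' * dH h h' + dA g g' + dH h r + dH r h')
        ≡⟨ sum²-+₄ N M _ _ _ _ ⟩
          sum² N M (λ g' h' → indicator g g' * dH h h') + sum² N M (λ g' _ → dA g g')
            + sum² N M (λ _ _ → dH h r) + sum² N M (λ _ h' → dH r h')
        ≡⟨ cong₂ _+_ (cong₂ _+_ (cong₂ _+_ (sum²-indicator N M g (dH h)) (sum²-fst N M (dA g)))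
                                (trans (sum²-snd N M _) (cong (N *_) (sum-const M (dH h r)))))
                     (sum²-snd N M (dH r)) ⟩
          sumFin M (dH h) + M * sumFin N (dA g) + N * (M * dH h r) + N * s
        ∎
        where
        open ≡-Reasoning
        detour : sum² N M (λ g' h' → indicator g g' * (dH h r + dH r h')) ≡ M * dH h r + s
        detour = trans (sum²-indicator N M g (λ h' → dH h r + dH r h'))
                       (trans (sum-+ M _ (dH r)) (cong (_+ s) (sum-const M (dH h r))))

      transmission : δ P + (N * (M * s) + N * (M * s))
        ≡ N * δ H + M * (M * δ A) + N * (N * (M * s)) + N * (M * (N * s))
      transmission = begin
          δ P + (N * (M * s) + N * (M * s))
        ≡⟨ cong₂ _+_ δ-coords (sym detours) ⟩
          sum² N M (λ g h → sum² N M (prodDist g h)) + sum² N M (λ g h → M * dH h r + s)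
        ≡⟨ sym (sum²-+ N M _ _) ⟩
          sum² N M (λ g h → sum² N M (prodDist g h) + (M * dH h r + s))
        ≡⟨ sum²-cong N M row-sum ⟩
          sum² N M (λ g h → sumFin M (dH h) + M * sumFin N (dA g) + N * (M * dH h r) + N * s)
        ≡⟨ sum²-+₄ N M _ _ _ _ ⟩
          sum² N M (λ _ h → sumFin M (dH h)) + sum² N M (λ g _ → M * sumFin N (dA g))
            + sum² N M (λ _ h → N * (M * dH h r)) + sum² N M (λ _ _ → N * s)
        ≡⟨ cong₂ _+_ (cong₂ _+_ (cong₂ _+_ (sum²-snd N M _)
                                           (trans (sum²-fst N M _) (cong (M *_) (sum-*ˡ N M _))))
                                (trans (sum²-snd N M _) (cong (N *_) (trans (sum-*ˡ M N _) (cong (N *_) rootSum)))))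
                     (trans (sum²-snd N M _) (cong (N *_) (sum-const M (N * s)))) ⟩
          N * δ H + M * (M * δ A) + N * (N * (M * s)) + N * (M * (N * s))
        ∎
        where
        open ≡-Reasoning
        rootSum : sumFin M (λ h → M * dH h r) ≡ M * s
        rootSum = trans (sum-*ˡ M M _) (cong (M *_) sum-to-root)
        detours : sum² N M (λ g h → M * dH h r + s) ≡ N * (M * s) + N * (M * s)
        detours = trans (sum²-+ N M _ _) (cong₂ _+_ (trans (sum²-snd N M _) (cong (N *_) rootSum))
                                                (trans (sum²-snd N M _) (cong (N *_) (sum-const M s))))

open import Data.Nat using (ℕ; zero; suc; _≤_; _∸_; _^_) renaming (_+_ to _ℕ+_; _*_ to _ℕ*_)
import Data.Nat
import Data.Nat.Properties as ℕ
open import Data.Integer using (ℤ; +_; _+_; _-_; _*_)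
open import Data.Integer.Properties using (pos-*)
open import Data.Integer.Tactic.RingSolver using (solve-∀)
open import Data.Nat.Tactic.RingSolver using () renaming (solve-∀ to ℕ-solve-∀)
open import Data.Product using (_×_; _,_; proj₁; proj₂)
open import Relation.Binary.PropositionalEquality using (_≡_; sym; trans; cong; cong₂; subst; module ≡-Reasoning)

-- The closed form a_k d + b_k s at k = j + 1, in terms of p = n^j and
-- g = 1 + n + ... + n^(j-1):  a_k = p (g + p),  b_k = 2 j n p² - 2 n p g.
closedForm : (n p g j d s : ℤ) → ℤ
closedForm n p g j d s = p * (g + p) * d + (+ 2 * j * (n * (p * p)) - + 2 * (n * p) * g) * s

recurrence : (N M d s x : ℤ) → ℤ
recurrence N M d s x =
  N * d + M * (M * x) + N * (N * (M * s)) + N * (M * (N * s)) - (N * (M * s) + N * (M * s))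

-- The inductive step as a polynomial identity, with n^j eliminated through
-- n^j = n g + 1 - g (g = 1 + n + ... + n^(j-1)).
closedForm-identity : ∀ n g j d s → let p = n * g + + 1 - g in
  recurrence (n * p) n d s (closedForm n p g j d s) ≡ closedForm n (n * p) (g + p) (+ 1 + j) d s
closedForm-identity = expanded
  where
  expanded : ∀ n g j d s → let p = n * g + + 1 - g ; N = n * p in
    N * d + n * (n * (p * (g + p) * d + (+ 2 * j * (n * (p * p)) - + 2 * (n * p) * g) * s))
      + N * (N * (n * s)) + N * (n * (N * s)) - (N * (n * s) + N * (n * s))
    ≡ N * ((g + p) + N) * d + (+ 2 * (+ 1 + j) * (n * (N * N)) - + 2 * (n * N) * (g + p)) * s
  expanded = solve-∀

closedForm-step : ∀ n p g j d s → n * g + + 1 ≡ g + p →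
  recurrence (n * p) n d s (closedForm n p g j d s) ≡ closedForm n (n * p) (g + p) (+ 1 + j) d s
closedForm-step n p g j d s horner =
  subst (λ q → recurrence (n * q) n d s (closedForm n q g j d s) ≡ closedForm n (n * q) (g + q) (+ 1 + j) d s)
        (trans (cong (_- g) horner) (cancel g p)) (closedForm-identity n g j d s)
  where
  cancel : ∀ g p → g + p - g ≡ p
  cancel = solve-∀

geom-horner : ∀ n j → n ℕ* geom n j ℕ+ 1 ≡ geom n (suc j)
geom-horner n zero    = cong (_ℕ+ 1) (ℕ.*-zeroʳ n)
geom-horner n (suc j) = trans (distrib n (geom n j) (n ^ j)) (cong (_ℕ+ n ℕ* n ^ j) (geom-horner n j))
  where
  distrib : ∀ n g p → n ℕ* (g ℕ+ p) ℕ+ 1 ≡ (n ℕ* g ℕ+ 1) ℕ+ n ℕ* p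
  distrib = ℕ-solve-∀

odd-power : ∀ n j → n ^ (2 ℕ* suc j ∸ 1) ≡ n ℕ* (n ^ j ℕ* n ^ j)
odd-power n j = trans (cong (n ^_) (trans (cong (λ t → j ℕ+ suc t) (ℕ.+-identityʳ j)) (ℕ.+-suc j j)))
                      (cong (n ℕ*_) (ℕ.^-distribˡ-+-* n j j))

pos-*² : ∀ a b c → + (a ℕ* (b ℕ* c)) ≡ + a * (+ b * + c)
pos-*² a b c = trans (pos-* a _) (cong (+ a *_) (pos-* b c))

pos-*³ : ∀ a b c e → + (a ℕ* (b ℕ* (c ℕ* e))) ≡ + a * (+ b * (+ c * + e))
pos-*³ a b c e = trans (pos-* a _) (cong (+ a *_) (pos-*² b c e))

recurrence-ℤ : ∀ {X} N M D Y s →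
  X ℕ+ (N ℕ* (M ℕ* s) ℕ+ N ℕ* (M ℕ* s))
    ≡ N ℕ* D ℕ+ M ℕ* (M ℕ* Y) ℕ+ N ℕ* (N ℕ* (M ℕ* s)) ℕ+ N ℕ* (M ℕ* (N ℕ* s)) →
  + X ≡ recurrence (+ N) (+ M) (+ D) (+ s) (+ Y)
recurrence-ℤ {X} N M D Y s eq = begin
    + X
  ≡⟨ add-sub (+ X) (+ (N ℕ* (M ℕ* s) ℕ+ N ℕ* (M ℕ* s))) ⟩
    + (X ℕ+ (N ℕ* (M ℕ* s) ℕ+ N ℕ* (M ℕ* s))) - + (N ℕ* (M ℕ* s) ℕ+ N ℕ* (M ℕ* s))
  ≡⟨ cong₂ _-_ (cong +_ eq) (cong₂ _+_ (pos-*² N M s) (pos-*² N M s)) ⟩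
    + (N ℕ* D ℕ+ M ℕ* (M ℕ* Y) ℕ+ N ℕ* (N ℕ* (M ℕ* s)) ℕ+ N ℕ* (M ℕ* (N ℕ* s))) - detour
  ≡⟨ cong (_- detour) (cong₂ _+_ (cong₂ _+_ (cong₂ _+_ (pos-* N D) (pos-*² M M Y)) (pos-*³ N N M s)) (pos-*³ N M N s)) ⟩
    recurrence (+ N) (+ M) (+ D) (+ s) (+ Y)
  ∎
  where
  open ≡-Reasoning
  detour = + N * (+ M * + s) + + N * (+ M * + s)
  add-sub : ∀ x c → x ≡ x + c - c
  add-sub = solve-∀

module Powers (G : RGraph) (simple : Simple G) (connected : Connected G) where

  n = size G
  d = + δ G
  s = + δ₀ G

  power-simple-connected : ∀ j → Simple (rpow G (suc j)) × Connected (rpow G (suc j))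
  power-simple-connected zero    = simple , connected
  power-simple-connected (suc j) with power-simple-connected j
  ... | simpleA , connectedA =
    RootedProduct.prod-simple (rpow G (suc j)) G simpleA simple ,
    RootedProduct.Distances.prod-connected (rpow G (suc j)) G connectedA connected

  power-size : ∀ j → size (rpow G (suc j)) ≡ n ^ suc j
  power-size zero    = sym (ℕ.*-identityʳ n)
  power-size (suc j) = trans (cong (_ℕ* n) (power-size j)) (ℕ.*-comm _ n)

  power-recurrence : ∀ j →
    + δ (rpow G (suc (suc j))) ≡ recurrence (+ n * + (n ^ j)) (+ n) d s (+ δ (rpow G (suc j)))
  power-recurrence j =
    trans (recurrence-ℤ (size (rpow G (suc j))) n (δ G) (δ (rpow G (suc j))) (δ₀ G) transmission)
          (cong (λ N → recurrence N (+ n) d s (+ δ (rpow G (suc j))))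
                (trans (cong +_ (power-size j)) (pos-* n (n ^ j))))
    where
    open RootedProduct.Distances (rpow G (suc j)) G (proj₂ (power-simple-connected j)) connected
      using (module Transmission)
    open Transmission simple using (transmission)

  power-closedForm : ∀ j → + δ (rpow G (suc j)) ≡ closedForm (+ n) (+ (n ^ j)) (+ geom n j) (+ j) d s
  power-closedForm zero    = base (+ n) d s
    where
    base : ∀ n d s → d ≡ + 1 * (+ 0 + + 1) * d + (+ 2 * + 0 * (n * (+ 1 * + 1)) - + 2 * (n * + 1) * + 0) * s
    base = solve-∀
  power-closedForm (suc j) = begin
      + δ (rpow G (suc (suc j)))
    ≡⟨ power-recurrence j ⟩
      recurrence (+ n * p) (+ n) d s (+ δ (rpow G (suc j)))
    ≡⟨ cong (recurrence (+ n * p) (+ n) d s) (power-closedForm j) ⟩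
      recurrence (+ n * p) (+ n) d s (closedForm (+ n) p g (+ j) d s)
    ≡⟨ closedForm-step (+ n) p g (+ j) d s (trans (sym (pos-+1 n (geom n j))) (cong +_ (geom-horner n j))) ⟩
      closedForm (+ n) (+ n * p) (g + p) (+ suc j) d s
    ≡⟨ cong (λ q → closedForm (+ n) q (g + p) (+ suc j) d s) (sym (pos-* n (n ^ j))) ⟩
      closedForm (+ n) (+ (n ^ suc j)) (+ geom n (suc j)) (+ suc j) d s
    ∎
    where
    open ≡-Reasoning
    p = + (n ^ j)
    g = + geom n j
    pos-+1 : ∀ n g → + (n ℕ* g ℕ+ 1) ≡ + n * + g + + 1
    pos-+1 n g = cong (_+ + 1) (pos-* n g)

  coefficients : ∀ j →
    (+ (n ^ j) * + geom n (suc j)) * d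
      + (+ 2 * + j * + (n ^ (2 ℕ* suc j ∸ 1)) - + 2 * + (n ^ suc j) * + geom n j) * s
    ≡ closedForm (+ n) (+ (n ^ j)) (+ geom n j) (+ j) d s
  coefficients j =
    cong₂ (λ Q P → (+ (n ^ j) * + geom n (suc j)) * d + (+ 2 * + j * Q - + 2 * P * + geom n j) * s)
          (trans (cong +_ (odd-power n j)) (pos-*² n (n ^ j) (n ^ j))) (pos-* n (n ^ j))

mainTheorem2 : (G : RGraph) → Simple G → Connected G → (k : ℕ) → 1 ≤ k →
    let n = size G in
    + δ (rpow G k)
      ≡ (+ (n ^ (k ∸ 1)) * + geom n k) * + δ G
        + (+ 2 * + (k ∸ 1) * + (n ^ (2 Data.Nat.* k ∸ 1))
           - + 2 * + (n ^ k) * + geom n (k ∸ 1)) * + δ₀ G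
mainTheorem2 G simple connected (suc j) _ =
  trans (power-closedForm j) (sym (coefficients j))
  where open Powers G simple connected
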